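{- Let $P$ be a poset in which every antichain is finite. Then $P$ is natural if and only if there exists a chain of finite down-sets $I^0\subseteq I^1\subseteq\cdots\subseteq I^n\subseteq\cdots$ of $P$ with $\bigcup_{n}I^n=P$.
   Context: A poset is natural if every antichain is finite, every descending chain stabilizes, and for every $p$ the set $\{p'\,:\,p'\le p\}$ is finite. -}

module Defs where

open import Level using (Level; _⊔_)
open import Data.Nat using (ℕ; suc) renaming (_≤_ to _≤ℕ_)
open import Data.List using (List)
open import Data.List.Relation.Unary.Any using (Any)
open import Data.Product using (_×_; ∃; ∃-syntax; Σ-syntax)
open import Relation.Unary using (Pred)
open import Relation.Binary.Bundles using (Poset)

module _ {c ℓ₁ ℓ₂ : Level} (P : Poset c ℓ₁ ℓ₂) where
  open Poset P

  Finite : ∀ {ℓ} → Pred Carrier ℓ → Set (c ⊔ ℓ₁ ⊔ ℓ)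
  Finite S = ∃[ xs ] (∀ x → S x → Any (x ≈_) xs)

  Antichain : ∀ {ℓ} → Pred Carrier ℓ → Set (c ⊔ ℓ₁ ⊔ ℓ₂ ⊔ ℓ)
  Antichain S = ∀ x y → S x → S y → x ≤ y → x ≈ y

  AntichainsFinite : Set (Level.suc (c ⊔ ℓ₁ ⊔ ℓ₂))
  AntichainsFinite = (S : Pred Carrier (c ⊔ ℓ₁ ⊔ ℓ₂)) → Antichain S → Finite S

  DescendingChainsStabilize : Set (c ⊔ ℓ₁ ⊔ ℓ₂)
  DescendingChainsStabilize =
    (f : ℕ → Carrier) → (∀ n → f (suc n) ≤ f n) →
    ∃[ N ] (∀ m → N ≤ℕ m → f m ≈ f N)

  ↓ : Carrier → Pred Carrier ℓ₂
  ↓ p = λ q → q ≤ p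

  Natural : Set (Level.suc (c ⊔ ℓ₁ ⊔ ℓ₂))
  Natural = AntichainsFinite × DescendingChainsStabilize × (∀ p → Finite (↓ p))

  DownSet : ∀ {ℓ} → Pred Carrier ℓ → Set (c ⊔ ℓ₂ ⊔ ℓ)
  DownSet I = ∀ p q → q ≤ p → I p → I q

  ExhaustingChainOfFiniteDownSets : Set (Level.suc (c ⊔ ℓ₁ ⊔ ℓ₂))
  ExhaustingChainOfFiniteDownSets =
    Σ[ I ∈ (ℕ → Pred Carrier (c ⊔ ℓ₁ ⊔ ℓ₂)) ]
      ( ((n : ℕ) → DownSet (I n) × Finite (I n))
      × ((n : ℕ) → ∀ x → I n x → I (suc n) x)
      × (∀ p → ∃[ n ] I n p) )

{-# OPTIONS --safe #-}
-- Call p of height at most n if every strict chain descending from p has at most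
-- n + 1 elements.  If every ↓ p is finite, p has height at most |↓ p|, so the
-- finite down-sets Iⁿ = {p : height p ≤ n} exhaust P; each Iⁿ is finite since the
-- elements of height exactly n + 1 form an antichain.  Conversely an exhausting
-- chain of finite down-sets makes every ↓ p finite, hence of finite height, and a
-- descending chain starting at an element of height n can drop at most n times.
module Submission where

open import Defs
open import Level using (_⊔_; Lift; lift; lower)
open import Relation.Binary.Bundles using (Poset; Setoid)
open import Function.Bundles using (_⇔_; mk⇔)
open import Axiom.ExcludedMiddle using (ExcludedMiddle)
open import Data.Nat using (ℕ; zero; suc; _+_; _∸_) renaming (_≤_ to _≤ℕ_)
open import Data.Nat.Properties using (m∸n+n≡m; m+n≤o⇒m≤o∸n; m+n≤o⇒n≤o; suc-injective)
open import Data.List using ([]; length; _++_)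
open import Data.List.Properties using (length-removeAt′)
open import Data.List.Relation.Unary.Any using (here; there; _─_)
open import Data.List.Relation.Unary.Any.Properties using (++⁺ˡ; ++⁺ʳ)
import Data.List.Membership.Setoid as SetoidMembership
open import Data.Product using (_×_; _,_; ∃-syntax)
open import Data.Sum using (_⊎_; inj₁; inj₂; map₂)
open import Data.Empty using (⊥-elim)
open import Relation.Nullary using (¬_; Dec; yes; no)
open import Relation.Nullary.Decidable using (map′; decidable-stable)
open import Relation.Binary.PropositionalEquality as ≡ using (_≡_; refl; subst)

module _ {c ℓ} (S : Setoid c ℓ) where
  open Setoid S
  open SetoidMembership S using (_∈_)

  ∈-─ : ∀ {x p xs} (p∈xs : p ∈ xs) → x ∈ xs → x ≈ p ⊎ x ∈ (xs ─ p∈xs)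
  ∈-─ (here p≈y)   (here x≈y)   = inj₁ (trans x≈y (sym p≈y))
  ∈-─ (here _)     (there x∈ys) = inj₂ x∈ys
  ∈-─ (there _)    (here x≈y)   = inj₂ (here x≈y)
  ∈-─ (there p∈ys) (there x∈ys) = map₂ there (∈-─ p∈ys x∈ys)

module _ {c ℓ₁ ℓ₂} (P : Poset c ℓ₁ ℓ₂) where
  open Poset P renaming (refl to ≤-refl; trans to ≤-trans)
  open SetoidMembership Eq.setoid using (_∈_)

  HeightAtMost : ℕ → Carrier → Set (c ⊔ ℓ₁ ⊔ ℓ₂)
  HeightAtMost zero    p = ∀ q → q ≤ p → q ≈ p
  HeightAtMost (suc n) p = ∀ q → q ≤ p → ¬ q ≈ p → HeightAtMost n q

  ≤-squeeze : ∀ {p q r} → r ≤ q → q ≤ p → r ≈ p → q ≈ p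
  ≤-squeeze r≤q q≤p r≈p = antisym q≤p (≤-trans (reflexive (Eq.sym r≈p)) r≤q)

  HeightAtMost-downSet : ∀ n → DownSet P (HeightAtMost n)
  HeightAtMost-downSet zero    p q q≤p h r r≤q = Eq.trans (h r (≤-trans r≤q q≤p)) (Eq.sym (h q q≤p))
  HeightAtMost-downSet (suc n) p q q≤p h r r≤q r≉q =
    h r (≤-trans r≤q q≤p) (λ r≈p → r≉q (Eq.trans r≈p (Eq.sym (≤-squeeze r≤q q≤p r≈p))))

  HeightAtMost-suc : ∀ n p → HeightAtMost n p → HeightAtMost (suc n) p
  HeightAtMost-suc zero    p h q q≤p q≉p = ⊥-elim (q≉p (h q q≤p))
  HeightAtMost-suc (suc n) p h q q≤p q≉p = HeightAtMost-suc n q (h q q≤p q≉p)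

  -- Removing p from a cover of ↓ p leaves a cover of ↓ q for every q < p.
  cover⇒HeightAtMost : ∀ n xs p → length xs ≡ n → (∀ q → q ≤ p → q ∈ xs) → HeightAtMost n p
  cover⇒HeightAtMost zero    [] p refl cover with cover p ≤-refl
  ... | ()
  cover⇒HeightAtMost (suc n) xs p |xs|≡1+n cover q q≤p q≉p =
    cover⇒HeightAtMost n (xs ─ p∈xs) q |xs─p|≡n cover↓q
    where
    p∈xs : p ∈ xs
    p∈xs = cover p ≤-refl
    |xs─p|≡n : length (xs ─ p∈xs) ≡ n
    |xs─p|≡n = suc-injective (≡.trans (≡.sym (length-removeAt′ xs _)) |xs|≡1+n)
    cover↓q : ∀ r → r ≤ q → r ∈ (xs ─ p∈xs)
    cover↓q r r≤q with ∈-─ Eq.setoid p∈xs (cover r (≤-trans r≤q q≤p))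
    ... | inj₁ r≈p = ⊥-elim (q≉p (≤-squeeze r≤q q≤p r≈p))
    ... | inj₂ r∈ = r∈

  ↓-finite⇒HeightAtMost : ∀ p → Finite P (↓ P p) → ∃[ n ] HeightAtMost n p
  ↓-finite⇒HeightAtMost p (xs , cover) = length xs , cover⇒HeightAtMost _ xs p refl cover

  exhaustingChain⇒↓-finite : ExhaustingChainOfFiniteDownSets P → ∀ p → Finite P (↓ P p)
  exhaustingChain⇒↓-finite (_ , downSet-finite , _ , exhaust) p with exhaust p
  ... | n , p∈Iₙ with downSet-finite n
  ...   | downSet , xs , cover = xs , λ q q≤p → cover q (downSet p q q≤p p∈Iₙ)

  Descending : (ℕ → Carrier) → Set ℓ₂
  Descending f = ∀ n → f (suc n) ≤ f n

  Stabilizes : (ℕ → Carrier) → Set ℓ₁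
  Stabilizes f = ∃[ N ] (∀ m → N ≤ℕ m → f m ≈ f N)

  descending⇒≤head : ∀ {f} → Descending f → ∀ m → f m ≤ f 0
  descending⇒≤head desc zero    = ≤-refl
  descending⇒≤head desc (suc m) = ≤-trans (desc m) (descending⇒≤head desc m)

  stabilizes-shift : ∀ f m → Stabilizes (λ k → f (k + m)) → Stabilizes f
  stabilizes-shift f m (N , stable) = N + m , λ m′ N+m≤m′ →
    subst (λ j → f j ≈ f (N + m)) (m∸n+n≡m (m+n≤o⇒n≤o N N+m≤m′))
      (stable (m′ ∸ m) (m+n≤o⇒m≤o∸n N N+m≤m′))

  module _ (em : ExcludedMiddle (c ⊔ ℓ₁ ⊔ ℓ₂)) where

    em-lower : {A : Set ℓ₁} → Dec A
    em-lower {A} = map′ lower lift (em {Lift (c ⊔ ℓ₁ ⊔ ℓ₂) A})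

    heightExactly-antichain : ∀ n → Antichain P (λ p → HeightAtMost (suc n) p × ¬ HeightAtMost n p)
    heightExactly-antichain n x y (_ , x∉) (y∈ , _) x≤y =
      decidable-stable em-lower (λ x≉y → x∉ (y∈ x x≤y x≉y))

    HeightAtMost-finite : AntichainsFinite P → ∀ n → Finite P (HeightAtMost n)
    HeightAtMost-finite AF zero = AF (HeightAtMost zero) (λ x y _ y-minimal x≤y → y-minimal x x≤y)
    HeightAtMost-finite AF (suc n) with HeightAtMost-finite AF n | AF _ (heightExactly-antichain n)
    ... | xs , cover≤n | ys , cover≡1+n = xs ++ ys , cover
      where
      cover : ∀ x → HeightAtMost (suc n) x → x ∈ (xs ++ ys)
      cover x h with em {HeightAtMost n x}
      ... | yes h′ = ++⁺ˡ (cover≤n x h′)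
      ... | no ¬h′ = ++⁺ʳ xs (cover≡1+n x (h , ¬h′))

    HeightAtMost⇒stabilizes : ∀ n f → Descending f → HeightAtMost n (f 0) → Stabilizes f
    HeightAtMost⇒stabilizes n f desc h with em-lower {∃[ m ] ¬ f m ≈ f 0}
    ... | no constant = 0 , λ m _ → decidable-stable em-lower (λ fm≉f0 → constant (m , fm≉f0))
    HeightAtMost⇒stabilizes zero f desc h | yes (m , fm≉f0) =
      ⊥-elim (fm≉f0 (h (f m) (descending⇒≤head desc m)))
    HeightAtMost⇒stabilizes (suc n) f desc h | yes (m , fm≉f0) =
      stabilizes-shift f m (HeightAtMost⇒stabilizes n (λ k → f (k + m)) (λ k → desc (k + m))
        (h (f m) (descending⇒≤head desc m) fm≉f0))

    ↓-finite⇒descendingChainsStabilize : (∀ p → Finite P (↓ P p)) → DescendingChainsStabilize P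
    ↓-finite⇒descendingChainsStabilize ↓-finite f desc with ↓-finite⇒HeightAtMost (f 0) (↓-finite (f 0))
    ... | n , h = HeightAtMost⇒stabilizes n f desc h

    natural⇒exhaustingChain : Natural P → ExhaustingChainOfFiniteDownSets P
    natural⇒exhaustingChain (AF , _ , ↓-finite) =
      HeightAtMost ,
      (λ n → HeightAtMost-downSet n , HeightAtMost-finite AF n) ,
      HeightAtMost-suc ,
      λ p → ↓-finite⇒HeightAtMost p (↓-finite p)

lemma6p4 : ∀ {c ℓ₁ ℓ₂} (P : Poset c ℓ₁ ℓ₂) →
    ExcludedMiddle (c ⊔ ℓ₁ ⊔ ℓ₂) →
    AntichainsFinite P →
    (Natural P ⇔ ExhaustingChainOfFiniteDownSets P)
lemma6p4 P em AF = mk⇔ (natural⇒exhaustingChain P em) natural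
  where
  natural : ExhaustingChainOfFiniteDownSets P → Natural P
  natural chain = AF , ↓-finite⇒descendingChainsStabilize P em ↓-finite , ↓-finite
    where ↓-finite = exhaustingChain⇒↓-finite P chain
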